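{- Let $n\geq 4$ and $\lceil n/2\rceil<m\leq n-1$. Then there is no optimal graph in $\mathcal{G}_{n,m}$.
   Context: All graphs are finite and simple. A set $S$ of vertices of a graph $G$ is dominating if every vertex of $G$ is in $S$ or adjacent to a vertex of $S$. The domination polynomial is $D(G,x)=\sum_{i=1}^{|V(G)|} d(G,i)x^i$, where $d(G,i)$ is the number of dominating sets of $G$ of cardinality $i$. $\mathcal{G}_{n,m}$ denotes the set of simple graphs with $n$ vertices and $m$ edges. A graph $H\in\mathcal{G}_{n,m}$ is optimal if $D(H,x)\geq D(G,x)$ for all $G\in\mathcal{G}_{n,m}$ and all $x\geq 0$. -}

module Defs where

open import Data.Bool using (Bool; true; false; _∧_; _∨_; if_then_else_)
open import Data.Nat using (ℕ; zero; suc; _<ᵇ_; _≡ᵇ_)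
open import Data.Fin using (Fin; toℕ)
open import Data.Fin.Subset using (Subset; ∣_∣)
open import Data.Vec using (Vec; []; _∷_; lookup)
open import Data.List using (List; []; _∷_; map; _++_; allFin; length; filter; concatMap)
open import Data.Nat.ListAction using (sum)
open import Data.Bool.ListAction using (all; any)
open import Data.Bool using (T?)
open import Data.Product using (_×_)
open import Data.Rational using (ℚ; 0ℚ; 1ℚ; _+_; _*_; _≤_; _/_)
open import Data.Integer using (+_)
open import Relation.Binary.PropositionalEquality using (_≡_)
open import Relation.Nullary using (¬_)

record Graph (n : ℕ) : Set where
  field
    adj    : Fin n → Fin n → Bool
    sym    : ∀ i j → adj i j ≡ adj j i
    irrefl : ∀ i → adj i i ≡ false
open Graph public

edgeCount : ∀ {n} → Graph n → ℕ
edgeCount {n} G =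
  sum (concatMap (λ i → map (λ j → if (toℕ i <ᵇ toℕ j) ∧ adj G i j then 1 else 0) (allFin n)) (allFin n))

mem : ∀ {n} → Subset n → Fin n → Bool
mem S v = lookup S v

isDominating : ∀ {n} → Graph n → Subset n → Bool
isDominating {n} G S =
  all (λ v → mem S v ∨ any (λ u → mem S u ∧ adj G u v) (allFin n)) (allFin n)

allSubsets : (n : ℕ) → List (Subset n)
allSubsets zero    = [] ∷ []
allSubsets (suc n) = map (true ∷_) (allSubsets n) ++ map (false ∷_) (allSubsets n)

d : ∀ {n} → Graph n → ℕ → ℕ
d {n} G i = length (filter (λ S → T? (isDominating G S ∧ (∣ S ∣ ≡ᵇ i))) (allSubsets n))

ℕ→ℚ : ℕ → ℚ
ℕ→ℚ k = + k / 1

pow : ℚ → ℕ → ℚ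
pow x zero    = 1ℚ
pow x (suc k) = x * pow x k

Dsum : ∀ {n} → Graph n → ℚ → ℕ → ℚ
Dsum G x zero    = 0ℚ
Dsum G x (suc k) = Dsum G x k + ℕ→ℚ (d G (suc k)) * pow x (suc k)

D : ∀ {n} → Graph n → ℚ → ℚ
D {n} G x = Dsum G x n

Optimal : (n m : ℕ) → Graph n → Set
Optimal n m H =
  edgeCount H ≡ m × (∀ (G : Graph n) → edgeCount G ≡ m → ∀ (x : ℚ) → 0ℚ ≤ x → D G x ≤ D H x)

-- Let H be optimal in G(n,m). If H has a dominating set S with |S| + m ≤ n, join every vertex
-- outside S to a chosen neighbour in S. These n − |S| ≥ m edges are distinct (a double count over
-- ordered pairs, using the handshake lemma), so they are all the edges of H: every edge ij has an
-- endpoint whose only neighbour is the other one, and V ∖ {i, j} is never dominating. A double star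
-- with a perfect matching on the remaining vertices has m edges, no isolated vertex and an edge ij
-- with V ∖ {i, j} dominating, so it has at least as many dominating sets of sizes n and n − 1 as H
-- and strictly more of size n − 2; it beats H for large x. Otherwise every dominating set of H has
-- more than n − m vertices, while K₁,ₘ plus isolated vertices has one with n − m; it beats H for
-- small x. Both comparisons are made at x = N and x = 1/N with N > 2ⁿ ≥ d(H, i), where they become
-- comparisons of numbers written in base N.

module Submission where

open import Defs renaming (sym to adj-sym; irrefl to adj-irrefl)

open import Algebra.Bundles using (CommutativeMonoid)
open import Data.Bool using (Bool; true; false; not; _∧_; _∨_; if_then_else_; T; T?)
open import Data.Bool.ListAction using (any)
open import Data.Bool.Properties
  using (T-≡; T-not-≡; T-∧; T-∨; ¬-not; not-injective; ∧-zeroʳ; ∧-identityʳ) renaming (_≟_ to _≟ᵇ_)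
open import Data.Empty as Empty using (⊥-elim)
open import Data.Fin using (Fin; toℕ; zero; suc; _↑ʳ_)
open import Data.Fin.Properties using (_≟_; toℕ-injective)
open import Data.Fin.Subset using (Subset; ∣_∣; ⊤; ⊥; ∁)
open import Data.Fin.Subset.Properties using (∣⊤∣≡n; ∣⊥∣≡0; ∣p∣≤n; ∣∁p∣≡n∸∣p∣; anySubset?)
import Data.Integer as ℤ
import Data.Integer.Properties as ℤP
open import Data.List using (List; []; _∷_; map; tabulate; concatMap; allFin; filter; length)
  renaming (_++_ to _++ᴸ_)
open import Data.List.Membership.Propositional using (lose)
open import Data.List.Membership.Propositional.Properties using (∈-allFin)
import Data.List.Relation.Unary.All as All
open import Data.List.Relation.Unary.All.Properties using (all⁺; all⁻)
open import Data.List.Relation.Unary.Any using (satisfied)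
open import Data.List.Relation.Unary.Any.Properties using (any⁺; any⁻)
open import Data.Nat as ℕ using (ℕ; zero; suc; _+_; _*_; _∸_; _^_; _≤_; _<_; _<ᵇ_; _≡ᵇ_; z≤n; s≤s; ⌈_/2⌉)
open import Data.Nat.Coprimality using (Coprime)
open import Data.Nat.Divisibility using (∣1⇒≡1)
open import Data.Nat.ListAction using () renaming (sum to listSum)
open import Data.Nat.ListAction.Properties using (sum-++)
import Data.Nat.Properties as ℕP
open import Data.Nat.Tactic.RingSolver using (solve-∀)
open import Data.Product using (Σ; ∃; ∃-syntax; ∃₂; _×_; _,_; proj₁; proj₂)
open import Data.Rational as ℚ using (ℚ; mkℚ; 0ℚ; 1ℚ; _/_)
import Data.Rational.Properties as ℚP
open import Data.Rational.Unnormalised as ℚᵘ using (mkℚᵘ)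
import Data.Rational.Unnormalised.Properties as ℚᵘP
open import Data.Sum using (_⊎_; inj₁; inj₂)
open import Data.Vec using ([]; _∷_; lookup; _++_)
open import Data.Vec.Properties using (lookup-map; lookup-++ʳ)
open import Function using (_∘_; Equivalence)
open import Relation.Binary.PropositionalEquality
  using (_≡_; _≢_; refl; sym; trans; cong; cong₂; subst; subst₂; module ≡-Reasoning)
open import Relation.Nullary using (¬_; Dec; yes; no; does; _×-dec_)

open import Algebra.Properties.CommutativeMonoid.Sum ℕP.+-0-commutativeMonoid
  using (sum; sum-syntax; sum-cong-≗; ∑-distrib-+; ∑-comm; sum-replicate-zero)
open import Algebra.Properties.CommutativeSemigroup
  (CommutativeMonoid.commutativeSemigroup ℚP.*-1-commutativeMonoid) using (interchange)

𝟙 : Bool → ℕ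
𝟙 b = if b then 1 else 0

𝟙≤1 : ∀ b → 𝟙 b ≤ 1
𝟙≤1 true  = ℕP.≤-refl
𝟙≤1 false = z≤n

∑-mono-≤ : ∀ {n} {f g : Fin n → ℕ} → (∀ i → f i ≤ g i) → sum f ≤ sum g
∑-mono-≤ {zero}  f≤g = z≤n
∑-mono-≤ {suc n} f≤g = ℕP.+-mono-≤ (f≤g zero) (∑-mono-≤ (f≤g ∘ suc))

∑-mono-< : ∀ {n} {f g : Fin n → ℕ} → (∀ i → f i ≤ g i) → ∀ i → f i < g i → sum f < sum g
∑-mono-< f≤g zero    f<g = ℕP.+-mono-<-≤ f<g (∑-mono-≤ (f≤g ∘ suc))
∑-mono-< f≤g (suc i) f<g = ℕP.+-mono-≤-< (f≤g zero) (∑-mono-< (f≤g ∘ suc) i f<g)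

∑-tight : ∀ {n} {f g : Fin n → ℕ} → (∀ i → f i ≤ g i) → sum g ≤ sum f → ∀ i → g i ≤ f i
∑-tight f≤g ∑g≤∑f i = ℕP.≮⇒≥ λ f<g → ℕP.<⇒≱ (∑-mono-< f≤g i f<g) ∑g≤∑f

∑∑-tight : ∀ {m n} {f g : Fin m → Fin n → ℕ} → (∀ i j → f i j ≤ g i j) →
           ∑[ i < m ] ∑[ j < n ] g i j ≤ ∑[ i < m ] ∑[ j < n ] f i j → ∀ i j → g i j ≤ f i j
∑∑-tight f≤g ∑∑g≤∑∑f i = ∑-tight (f≤g i) (∑-tight (λ i → ∑-mono-≤ (f≤g i)) ∑∑g≤∑∑f i)

∑∑-distrib-+ : ∀ {m n} (f g : Fin m → Fin n → ℕ) →
  ∑[ i < m ] ∑[ j < n ] (f i j + g i j) ≡ ∑[ i < m ] ∑[ j < n ] f i j + ∑[ i < m ] ∑[ j < n ] g i j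
∑∑-distrib-+ {n = n} f g = trans (sum-cong-≗ (λ i → ∑-distrib-+ (f i) (g i)))
                                 (∑-distrib-+ (λ i → ∑[ j < n ] f i j) (λ i → ∑[ j < n ] g i j))

∑-𝟙-∧-≟ : ∀ {n} b (c : Fin n) → ∑[ i < n ] 𝟙 (b ∧ does (c ≟ i)) ≡ 𝟙 b
∑-𝟙-∧-≟ {n}     false c       = sum-replicate-zero n
∑-𝟙-∧-≟ {suc n} true  zero    = cong suc (sum-replicate-zero n)
∑-𝟙-∧-≟         true  (suc c) = ∑-𝟙-∧-≟ true c

sum-map-tabulate : ∀ {A : Set} {n} (g : A → ℕ) (f : Fin n → A) →
                   listSum (map g (tabulate f)) ≡ sum (g ∘ f)
sum-map-tabulate {n = zero}  g f = refl
sum-map-tabulate {n = suc n} g f = cong (g (f zero) +_) (sum-map-tabulate g (f ∘ suc))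

sum-concatMap-tabulate : ∀ {A : Set} {n} (g : A → List ℕ) (f : Fin n → A) →
                         listSum (concatMap g (tabulate f)) ≡ sum (listSum ∘ g ∘ f)
sum-concatMap-tabulate {n = zero}  g f = refl
sum-concatMap-tabulate {n = suc n} g f =
  trans (sum-++ (g (f zero)) _) (cong (listSum (g (f zero)) +_) (sum-concatMap-tabulate g (f ∘ suc)))

∣∣≡∑ : ∀ {n} (S : Subset n) → ∣ S ∣ ≡ ∑[ i < n ] 𝟙 (lookup S i)
∣∣≡∑ []          = refl
∣∣≡∑ (true  ∷ S) = cong suc (∣∣≡∑ S)
∣∣≡∑ (false ∷ S) = ∣∣≡∑ S

_≺_ : ∀ {n} → Fin n → Fin n → Bool
i ≺ j = toℕ i <ᵇ toℕ j

edgeCount≡∑ : ∀ {n} (G : Graph n) → edgeCount G ≡ ∑[ i < n ] ∑[ j < n ] 𝟙 (i ≺ j ∧ adj G i j)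
edgeCount≡∑ {n} G =
  trans (sum-concatMap-tabulate (λ i → map (λ j → 𝟙 (i ≺ j ∧ adj G i j)) (allFin n)) (λ i → i))
        (sum-cong-≗ (λ i → sum-map-tabulate (λ j → 𝟙 (i ≺ j ∧ adj G i j)) (λ j → j)))

cons : ∀ {n} → Subset n → Graph n → Graph (suc n)
cons {n} N G = record { adj = A ; sym = A-sym ; irrefl = A-irrefl }
  where
  A : Fin (suc n) → Fin (suc n) → Bool
  A zero    zero    = false
  A zero    (suc j) = lookup N j
  A (suc i) zero    = lookup N i
  A (suc i) (suc j) = adj G i j

  A-sym : ∀ i j → A i j ≡ A j i
  A-sym zero    zero    = refl
  A-sym zero    (suc j) = refl
  A-sym (suc i) zero    = refl
  A-sym (suc i) (suc j) = adj-sym G i j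

  A-irrefl : ∀ i → A i i ≡ false
  A-irrefl zero    = refl
  A-irrefl (suc i) = adj-irrefl G i

-- Since zero ≺ suc j and suc i ≺ zero compute, the double sum for cons N G splits by computation
-- into the row of the new vertex and the double sum for G.
edgeCount-cons : ∀ {n} (N : Subset n) (G : Graph n) → edgeCount (cons N G) ≡ ∣ N ∣ + edgeCount G
edgeCount-cons N G = trans (edgeCount≡∑ (cons N G)) (cong₂ _+_ (sym (∣∣≡∑ N)) (sym (edgeCount≡∑ G)))

edgeCount-cons-⊥ : ∀ {n} (G : Graph n) → edgeCount (cons ⊥ G) ≡ edgeCount G
edgeCount-cons-⊥ {n} G = trans (edgeCount-cons ⊥ G) (cong (_+ edgeCount G) (∣⊥∣≡0 n))

∁⁅_⁆ : ∀ {n} → Fin n → Subset n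
∁⁅ zero  ⁆ = false ∷ ⊤
∁⁅ suc i ⁆ = true ∷ ∁⁅ i ⁆

-- ⸴ (U+2E34) separates the two points because `,` is the pair constructor.
∁⁅_⸴_⁆ : ∀ {n} → Fin n → Fin n → Subset n
∁⁅ zero  ⸴ zero  ⁆ = false ∷ ⊤
∁⁅ zero  ⸴ suc j ⁆ = false ∷ ∁⁅ j ⁆
∁⁅ suc i ⸴ zero  ⁆ = false ∷ ∁⁅ i ⁆
∁⁅ suc i ⸴ suc j ⁆ = true ∷ ∁⁅ i ⸴ j ⁆

mem-⊤ : ∀ {n} (v : Fin n) → mem ⊤ v ≡ true
mem-⊤ zero    = refl
mem-⊤ (suc v) = mem-⊤ v

mem-∁⁅⁆ : ∀ {n} {i v : Fin n} → v ≢ i → mem ∁⁅ i ⁆ v ≡ true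
mem-∁⁅⁆ {i = zero}  {zero}  v≢i = ⊥-elim (v≢i refl)
mem-∁⁅⁆ {i = zero}  {suc v} v≢i = mem-⊤ v
mem-∁⁅⁆ {i = suc i} {zero}  v≢i = refl
mem-∁⁅⁆ {i = suc i} {suc v} v≢i = mem-∁⁅⁆ (v≢i ∘ cong suc)

mem-∁⁅⁆-self : ∀ {n} (i : Fin n) → mem ∁⁅ i ⁆ i ≡ false
mem-∁⁅⁆-self zero    = refl
mem-∁⁅⁆-self (suc i) = mem-∁⁅⁆-self i

mem-∁⁅⸴⁆ : ∀ {n} {i j v : Fin n} → v ≢ i → v ≢ j → mem ∁⁅ i ⸴ j ⁆ v ≡ true
mem-∁⁅⸴⁆ {i = zero}  {zero}  {zero}  v≢i _   = ⊥-elim (v≢i refl)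
mem-∁⁅⸴⁆ {i = zero}  {zero}  {suc v} _   _   = mem-⊤ v
mem-∁⁅⸴⁆ {i = zero}  {suc j} {zero}  v≢i _   = ⊥-elim (v≢i refl)
mem-∁⁅⸴⁆ {i = zero}  {suc j} {suc v} _   v≢j = mem-∁⁅⁆ (v≢j ∘ cong suc)
mem-∁⁅⸴⁆ {i = suc i} {zero}  {zero}  _   v≢j = ⊥-elim (v≢j refl)
mem-∁⁅⸴⁆ {i = suc i} {zero}  {suc v} v≢i _   = mem-∁⁅⁆ (v≢i ∘ cong suc)
mem-∁⁅⸴⁆ {i = suc i} {suc j} {zero}  _   _   = refl
mem-∁⁅⸴⁆ {i = suc i} {suc j} {suc v} v≢i v≢j = mem-∁⁅⸴⁆ (v≢i ∘ cong suc) (v≢j ∘ cong suc)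

mem-∁⁅⸴⁆-left : ∀ {n} (i j : Fin n) → mem ∁⁅ i ⸴ j ⁆ i ≡ false
mem-∁⁅⸴⁆-left zero    zero    = refl
mem-∁⁅⸴⁆-left zero    (suc j) = refl
mem-∁⁅⸴⁆-left (suc i) zero    = mem-∁⁅⁆-self i
mem-∁⁅⸴⁆-left (suc i) (suc j) = mem-∁⁅⸴⁆-left i j

mem-∁⁅⸴⁆-right : ∀ {n} (i j : Fin n) → mem ∁⁅ i ⸴ j ⁆ j ≡ false
mem-∁⁅⸴⁆-right zero    zero    = refl
mem-∁⁅⸴⁆-right zero    (suc j) = mem-∁⁅⁆-self j
mem-∁⁅⸴⁆-right (suc i) zero    = refl
mem-∁⁅⸴⁆-right (suc i) (suc j) = mem-∁⁅⸴⁆-right i j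

countSubsets : ∀ {n} → (Subset n → Bool) → ℕ
countSubsets {zero}  c = 𝟙 (c [])
countSubsets {suc n} c = countSubsets (c ∘ (true ∷_)) + countSubsets (c ∘ (false ∷_))

length-filter-++ : ∀ {A : Set} (c : A → Bool) (xs ys : List A) →
  length (filter (T? ∘ c) (xs ++ᴸ ys)) ≡ length (filter (T? ∘ c) xs) + length (filter (T? ∘ c) ys)
length-filter-++ c []       ys = refl
length-filter-++ c (x ∷ xs) ys with c x
... | true  = cong suc (length-filter-++ c xs ys)
... | false = length-filter-++ c xs ys

length-filter-map : ∀ {A B : Set} (c : B → Bool) (f : A → B) (xs : List A) →
  length (filter (T? ∘ c) (map f xs)) ≡ length (filter (T? ∘ c ∘ f) xs)
length-filter-map c f []       = refl
length-filter-map c f (x ∷ xs) with c (f x)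
... | true  = cong suc (length-filter-map c f xs)
... | false = length-filter-map c f xs

length-filter-allSubsets : ∀ n (c : Subset n → Bool) → length (filter (T? ∘ c) (allSubsets n)) ≡ countSubsets c
length-filter-allSubsets zero    c with c []
... | true  = refl
... | false = refl
length-filter-allSubsets (suc n) c =
  trans (length-filter-++ c (map (true ∷_) (allSubsets n)) _)
        (cong₂ _+_ (trans (length-filter-map c (true ∷_) (allSubsets n)) (length-filter-allSubsets n _))
                   (trans (length-filter-map c (false ∷_) (allSubsets n)) (length-filter-allSubsets n _)))

countSubsets-≤ : ∀ {n} (c : Subset n → Bool) → countSubsets c ≤ 2 ^ n
countSubsets-≤ {zero}  c = 𝟙≤1 (c [])
countSubsets-≤ {suc n} c = subst (countSubsets c ≤_) (cong (2 ^ n +_) (sym (ℕP.+-identityʳ (2 ^ n))))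
  (ℕP.+-mono-≤ (countSubsets-≤ (c ∘ (true ∷_))) (countSubsets-≤ (c ∘ (false ∷_))))

countSubsets-none : ∀ {n} (c : Subset n → Bool) → (∀ S → c S ≡ false) → countSubsets c ≡ 0
countSubsets-none {zero}  c none = cong 𝟙 (none [])
countSubsets-none {suc n} c none =
  cong₂ _+_ (countSubsets-none _ (none ∘ (true ∷_))) (countSubsets-none _ (none ∘ (false ∷_)))

countSubsets-pos : ∀ {n} (c : Subset n → Bool) (S : Subset n) → c S ≡ true → 0 < countSubsets c
countSubsets-pos c []          cS = subst (λ b → 0 < 𝟙 b) (sym cS) ℕP.0<1+n
countSubsets-pos c (true  ∷ S) cS = ℕP.<-≤-trans (countSubsets-pos (c ∘ (true ∷_)) S cS) (ℕP.m≤m+n _ _)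
countSubsets-pos c (false ∷ S) cS = ℕP.<-≤-trans (countSubsets-pos (c ∘ (false ∷_)) S cS) (ℕP.m≤n+m _ _)

≡ᵇ-≢ : ∀ {m n} → m ≢ n → (m ≡ᵇ n) ≡ false
≡ᵇ-≢ {m} {n} m≢n = ¬-not (m≢n ∘ ℕP.≡ᵇ⇒≡ m n ∘ Equivalence.from T-≡)

countSubsets-full : ∀ {n} (c : Subset n → Bool) → countSubsets (λ S → c S ∧ (∣ S ∣ ≡ᵇ n)) ≡ 𝟙 (c ⊤)
countSubsets-full {zero}  c = cong 𝟙 (∧-identityʳ (c []))
countSubsets-full {suc n} c = begin
  countSubsets (λ S → c (true ∷ S) ∧ (∣ S ∣ ≡ᵇ n)) + countSubsets (λ S → c (false ∷ S) ∧ (∣ S ∣ ≡ᵇ suc n))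
    ≡⟨ cong₂ _+_ (countSubsets-full (c ∘ (true ∷_))) (countSubsets-none _ too-small) ⟩
  𝟙 (c ⊤) + 0
    ≡⟨ ℕP.+-identityʳ _ ⟩
  𝟙 (c ⊤) ∎
  where
  open ≡-Reasoning
  too-small : ∀ S → (c (false ∷ S) ∧ (∣ S ∣ ≡ᵇ suc n)) ≡ false
  too-small S = trans (cong (c (false ∷ S) ∧_) (≡ᵇ-≢ (ℕP.<⇒≢ (s≤s (∣p∣≤n S))))) (∧-zeroʳ _)

countSubsets-∁⁅⁆ : ∀ {n} (c : Subset (suc n) → Bool) →
  countSubsets (λ S → c S ∧ (∣ S ∣ ≡ᵇ n)) ≡ ∑[ i < suc n ] 𝟙 (c ∁⁅ i ⁆)
countSubsets-∁⁅⁆ {zero}  c rewrite ∧-zeroʳ (c (true ∷ [])) | ∧-identityʳ (c (false ∷ [])) =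
  ℕP.+-comm 0 _
countSubsets-∁⁅⁆ {suc n} c =
  trans (cong₂ _+_ (countSubsets-∁⁅⁆ (c ∘ (true ∷_))) (countSubsets-full (c ∘ (false ∷_))))
        (ℕP.+-comm (∑[ i < suc n ] 𝟙 (c (true ∷ ∁⁅ i ⁆))) _)

countSubsets-∁⁅⸴⁆ : ∀ {n} (c : Subset (2 + n) → Bool) →
  countSubsets (λ S → c S ∧ (∣ S ∣ ≡ᵇ n)) ≡ ∑[ i < 2 + n ] ∑[ j < 2 + n ] 𝟙 (i ≺ j ∧ c ∁⁅ i ⸴ j ⁆)
countSubsets-∁⁅⸴⁆ {zero} c
  rewrite ∧-zeroʳ (c (true ∷ true ∷ [])) | ∧-zeroʳ (c (true ∷ false ∷ []))
        | ∧-zeroʳ (c (false ∷ true ∷ [])) | ∧-identityʳ (c (false ∷ false ∷ [])) =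
  sym (trans (ℕP.+-identityʳ _) (ℕP.+-identityʳ _))
countSubsets-∁⁅⸴⁆ {suc n} c =
  trans (cong₂ _+_ (countSubsets-∁⁅⸴⁆ (c ∘ (true ∷_))) (countSubsets-∁⁅⁆ (c ∘ (false ∷_))))
        (ℕP.+-comm (∑[ i < 2 + n ] ∑[ j < 2 + n ] 𝟙 (i ≺ j ∧ c (true ∷ ∁⁅ i ⸴ j ⁆))) _)

true≢false : ∀ {A : Set} → true ≡ false → A
true≢false ()

covered : ∀ {n} → Graph n → Subset n → Fin n → Bool
covered {n} G S v = mem S v ∨ any (λ u → mem S u ∧ adj G u v) (allFin n)

dominating⁻ : ∀ {n} (G : Graph n) S → isDominating G S ≡ true →
              ∀ v → mem S v ≡ false → ∃[ u ] mem S u ≡ true × adj G u v ≡ true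
dominating⁻ {n} G S dom v v∉S
  with Equivalence.to T-∨ (All.lookup (all⁺ (covered G S) (allFin n) (Equivalence.from T-≡ dom)) (∈-allFin v))
... | inj₁ v∈S = ⊥-elim (subst T v∉S v∈S)
... | inj₂ some with satisfied (any⁻ (λ u → mem S u ∧ adj G u v) (allFin n) some)
...   | u , u∈S∧uv = let u∈S , uv = Equivalence.to T-∧ u∈S∧uv
                     in u , Equivalence.to T-≡ u∈S , Equivalence.to T-≡ uv

dominating⁺ : ∀ {n} (G : Graph n) S →
              (∀ v → mem S v ≡ false → ∃[ u ] mem S u ≡ true × adj G u v ≡ true) → isDominating G S ≡ true
dominating⁺ {n} G S dom =
  Equivalence.to T-≡ (all⁻ (covered G S) (All.tabulate {xs = allFin n} λ {v} _ → dominated v))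
  where
  dominated : ∀ v → T (covered G S v)
  dominated v with mem S v in v∈S
  ... | true  = _
  ... | false = let u , u∈S , uv = dom v v∈S in
    any⁺ _ (lose (∈-allFin u) (Equivalence.from T-∧ (Equivalence.from T-≡ u∈S , Equivalence.from T-≡ uv)))

undominated : ∀ {n} (G : Graph n) S v → mem S v ≡ false →
              (∀ u → mem S u ≡ true → adj G u v ≡ false) → isDominating G S ≡ false
undominated G S v v∉S no-neighbour = ¬-not λ dom →
  let u , u∈S , uv = dominating⁻ G S dom v v∉S in true≢false (trans (sym uv) (no-neighbour u u∈S))

NoIsolated : ∀ {n} → Graph n → Set
NoIsolated {n} G = ∀ v → ∃[ u ] adj G u v ≡ true

adj⇒≢ : ∀ {n} (G : Graph n) {u v} → adj G u v ≡ true → u ≢ v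
adj⇒≢ G {u} uv refl = true≢false (trans (sym uv) (adj-irrefl G u))

⊤-dominating : ∀ {n} (G : Graph n) → isDominating G ⊤ ≡ true
⊤-dominating G = dominating⁺ G ⊤ λ v v∉⊤ → true≢false (trans (sym (mem-⊤ v)) v∉⊤)

∁⁅⁆-dominating : ∀ {n} {G : Graph n} → NoIsolated G → ∀ i → isDominating G ∁⁅ i ⁆ ≡ true
∁⁅⁆-dominating {G = G} no-isolated i = dominating⁺ G ∁⁅ i ⁆ dominated
  where
  dominated : ∀ v → mem ∁⁅ i ⁆ v ≡ false → ∃[ u ] mem ∁⁅ i ⁆ u ≡ true × adj G u v ≡ true
  dominated v v∉ with v ≟ i
  ... | yes refl = let u , uv = no-isolated v in u , mem-∁⁅⁆ (adj⇒≢ G uv) , uv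
  ... | no  v≢i  = true≢false (trans (sym (mem-∁⁅⁆ v≢i)) v∉)

∁⁅⸴⁆-dominating : ∀ {n} {G : Graph n} → NoIsolated G →
                  ∀ {i j} → adj G i j ≡ false → isDominating G ∁⁅ i ⸴ j ⁆ ≡ true
∁⁅⸴⁆-dominating {G = G} no-isolated {i} {j} ¬ij = dominating⁺ G ∁⁅ i ⸴ j ⁆ dominated
  where
  dominated : ∀ v → mem ∁⁅ i ⸴ j ⁆ v ≡ false → ∃[ u ] mem ∁⁅ i ⸴ j ⁆ u ≡ true × adj G u v ≡ true
  dominated v v∉ with v ≟ i | v ≟ j
  ... | yes refl | _ = let u , uv = no-isolated v in
    u , mem-∁⁅⸴⁆ {i = v} {j} (adj⇒≢ G uv) (λ { refl → true≢false (trans (sym uv) (trans (adj-sym G j v) ¬ij)) })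
      , uv
  ... | no _ | yes refl = let u , uv = no-isolated v in
    u , mem-∁⁅⸴⁆ {i = i} {v} (λ { refl → true≢false (trans (sym uv) ¬ij) }) (adj⇒≢ G uv) , uv
  ... | no v≢i | no v≢j = true≢false (trans (sym (mem-∁⁅⸴⁆ v≢i v≢j)) v∉)

Pendant : ∀ {n} → Graph n → Fin n → Fin n → Set
Pendant G a b = ∀ u → adj G u b ≡ true → u ≡ a

pendant-undominated : ∀ {n} (G : Graph n) S {a b} → Pendant G a b →
                      mem S a ≡ false → mem S b ≡ false → isDominating G S ≡ false
pendant-undominated G S {a} {b} pendant a∉S b∉S = undominated G S b b∉S λ u u∈S →
  ¬-not λ ub → true≢false (trans (sym u∈S) (trans (cong (mem S) (pendant u ub)) a∉S))

d≡countSubsets : ∀ {n} (G : Graph n) i → d G i ≡ countSubsets (λ S → isDominating G S ∧ (∣ S ∣ ≡ᵇ i))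
d≡countSubsets {n} G i = length-filter-allSubsets n (λ S → isDominating G S ∧ (∣ S ∣ ≡ᵇ i))

d≤2^n : ∀ {n} (G : Graph n) i → d G i ≤ 2 ^ n
d≤2^n G i = subst (_≤ _) (sym (d≡countSubsets G i)) (countSubsets-≤ (λ S → isDominating G S ∧ (∣ S ∣ ≡ᵇ i)))

d-vanishes : ∀ {n} (G : Graph n) i → (∀ S → isDominating G S ≡ true → ∣ S ∣ ≢ i) → d G i ≡ 0
d-vanishes G i too-big = trans (d≡countSubsets G i) (countSubsets-none _ none)
  where
  none : ∀ S → (isDominating G S ∧ (∣ S ∣ ≡ᵇ i)) ≡ false
  none S with isDominating G S in dom
  ... | true  = ≡ᵇ-≢ (too-big S dom)
  ... | false = refl

d-pos : ∀ {n} (G : Graph n) S → isDominating G S ≡ true → 0 < d G ∣ S ∣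
d-pos G S dom = subst (0 <_) (sym (d≡countSubsets G ∣ S ∣))
  (countSubsets-pos _ S (cong₂ _∧_ dom (Equivalence.to T-≡ (ℕP.≡⇒≡ᵇ ∣ S ∣ ∣ S ∣ refl))))

d-full : ∀ {n} (G : Graph n) → d G n ≡ 1
d-full {n} G = trans (d≡countSubsets G n) (trans (countSubsets-full (isDominating G)) (cong 𝟙 (⊤-dominating G)))

d-∁⁅⁆ : ∀ {n} (G : Graph (suc n)) → d G n ≡ ∑[ i < suc n ] 𝟙 (isDominating G ∁⁅ i ⁆)
d-∁⁅⁆ {n} G = trans (d≡countSubsets G n) (countSubsets-∁⁅⁆ (isDominating G))

d-∁⁅⸴⁆ : ∀ {n} (G : Graph (2 + n)) →
         d G n ≡ ∑[ i < 2 + n ] ∑[ j < 2 + n ] 𝟙 (i ≺ j ∧ isDominating G ∁⁅ i ⸴ j ⁆)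
d-∁⁅⸴⁆ {n} G = trans (d≡countSubsets G n) (countSubsets-∁⁅⸴⁆ (isDominating G))

-- A small dominating set forces every edge to be pendant

<ᵇ-trichotomy : ∀ x y → x ≢ y → 𝟙 (x <ᵇ y) + 𝟙 (y <ᵇ x) ≡ 1
<ᵇ-trichotomy zero    zero    x≢y = ⊥-elim (x≢y refl)
<ᵇ-trichotomy zero    (suc y) _   = refl
<ᵇ-trichotomy (suc x) zero    _   = refl
<ᵇ-trichotomy (suc x) (suc y) x≢y = <ᵇ-trichotomy x y (x≢y ∘ cong suc)

≺-trichotomy : ∀ {n} {i j : Fin n} → i ≢ j → 𝟙 (i ≺ j) + 𝟙 (j ≺ i) ≡ 1
≺-trichotomy i≢j = <ᵇ-trichotomy _ _ (i≢j ∘ toℕ-injective)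

handshake : ∀ {n} (G : Graph n) → ∑[ i < n ] ∑[ j < n ] 𝟙 (adj G i j) ≡ edgeCount G + edgeCount G
handshake {n} G = begin
  ∑[ i < n ] ∑[ j < n ] 𝟙 (adj G i j)
    ≡⟨ sum-cong-≗ (λ i → sum-cong-≗ (split i)) ⟩
  ∑[ i < n ] ∑[ j < n ] (𝟙 (i ≺ j ∧ adj G i j) + 𝟙 (j ≺ i ∧ adj G j i))
    ≡⟨ ∑∑-distrib-+ (λ i j → 𝟙 (i ≺ j ∧ adj G i j)) (λ i j → 𝟙 (j ≺ i ∧ adj G j i)) ⟩
  ∑[ i < n ] ∑[ j < n ] 𝟙 (i ≺ j ∧ adj G i j) + ∑[ i < n ] ∑[ j < n ] 𝟙 (j ≺ i ∧ adj G j i)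
    ≡⟨ cong (∑[ i < n ] ∑[ j < n ] 𝟙 (i ≺ j ∧ adj G i j) +_) (∑-comm (λ i j → 𝟙 (j ≺ i ∧ adj G j i))) ⟩
  ∑[ i < n ] ∑[ j < n ] 𝟙 (i ≺ j ∧ adj G i j) + ∑[ j < n ] ∑[ i < n ] 𝟙 (j ≺ i ∧ adj G j i)
    ≡⟨ cong₂ _+_ (sym (edgeCount≡∑ G)) (sym (edgeCount≡∑ G)) ⟩
  edgeCount G + edgeCount G ∎
  where
  open ≡-Reasoning
  split : ∀ i j → 𝟙 (adj G i j) ≡ 𝟙 (i ≺ j ∧ adj G i j) + 𝟙 (j ≺ i ∧ adj G j i)
  split i j rewrite adj-sym G j i with adj G i j in ij
  ... | false = sym (cong₂ _+_ (cong 𝟙 (∧-zeroʳ (i ≺ j))) (cong 𝟙 (∧-zeroʳ (j ≺ i))))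
  ... | true  = sym (trans (cong₂ _+_ (cong 𝟙 (∧-identityʳ (i ≺ j))) (cong 𝟙 (∧-identityʳ (j ≺ i))))
                           (≺-trichotomy (adj⇒≢ G ij)))

module _ {n} (H : Graph n) (S : Subset n) (S-dominating : isDominating H S ≡ true)
         (small : ∣ S ∣ + edgeCount H ≤ n) where

  -- Passing the equation mem S v ≡ b to parentOf lets parent-spec case on mem S v; a `with` on
  -- mem S v would be ill-typed, since parent v itself mentions it.
  parentOf : ∀ v b → mem S v ≡ b → Fin n
  parentOf v true  _   = v
  parentOf v false v∉S = proj₁ (dominating⁻ H S S-dominating v v∉S)

  parent : Fin n → Fin n
  parent v = parentOf v (mem S v) refl

  parent-spec : ∀ v → mem S v ≡ false → mem S (parent v) ≡ true × adj H (parent v) v ≡ true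
  parent-spec v = spec (mem S v) refl
    where
    spec : ∀ b (e : mem S v ≡ b) → b ≡ false → mem S (parentOf v b e) ≡ true × adj H (parentOf v b e) v ≡ true
    spec false e refl = proj₂ (dominating⁻ H S S-dominating v e)

  owns : Fin n → Fin n → Bool
  owns i j = not (mem S j) ∧ does (parent j ≟ i)

  owns⇒ : ∀ {i j} → owns i j ≡ true → mem S j ≡ false × parent j ≡ i
  owns⇒ {i} {j} ij with parent j ≟ i
  ... | yes pj≡i = Equivalence.to T-not-≡ (Equivalence.from T-≡ (trans (sym (∧-identityʳ _)) ij)) , pj≡i
  ... | no  _    = true≢false (trans (sym ij) (∧-zeroʳ _))

  ∑∑-owns : ∑[ i < n ] ∑[ j < n ] 𝟙 (owns i j) ≡ ∣ ∁ S ∣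
  ∑∑-owns = begin
    ∑[ i < n ] ∑[ j < n ] 𝟙 (owns i j) ≡⟨ ∑-comm (λ i j → 𝟙 (owns i j)) ⟩
    ∑[ j < n ] ∑[ i < n ] 𝟙 (owns i j) ≡⟨ sum-cong-≗ owned-once ⟩
    ∑[ j < n ] 𝟙 (lookup (∁ S) j)      ≡⟨ sym (∣∣≡∑ (∁ S)) ⟩
    ∣ ∁ S ∣                            ∎
    where
    open ≡-Reasoning
    owned-once : ∀ j → ∑[ i < n ] 𝟙 (owns i j) ≡ 𝟙 (lookup (∁ S) j)
    owned-once j = trans (∑-𝟙-∧-≟ (not (mem S j)) (parent j)) (cong 𝟙 (sym (lookup-map j not S)))

  owns-≤-adj : ∀ i j → 𝟙 (owns i j) + 𝟙 (owns j i) ≤ 𝟙 (adj H i j)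
  owns-≤-adj i j with owns i j in ij | owns j i in ji
  ... | false | false = z≤n
  ... | true  | true  = let j∉S , pj≡i = owns⇒ ij ; i∉S , _ = owns⇒ ji in
    true≢false (trans (sym (proj₁ (parent-spec j j∉S))) (trans (cong (mem S) pj≡i) i∉S))
  ... | true  | false = let j∉S , pj≡i = owns⇒ ij in
    ℕP.≤-reflexive (cong 𝟙 (sym (subst (λ u → adj H u j ≡ true) pj≡i (proj₂ (parent-spec j j∉S)))))
  ... | false | true  = let i∉S , pi≡j = owns⇒ ji in
    ℕP.≤-reflexive (cong 𝟙 (sym (trans (adj-sym H i j)
      (subst (λ u → adj H u i ≡ true) pi≡j (proj₂ (parent-spec i i∉S))))))

  adj-≤-owns : ∀ i j → 𝟙 (adj H i j) ≤ 𝟙 (owns i j) + 𝟙 (owns j i)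
  adj-≤-owns = ∑∑-tight owns-≤-adj
    (subst₂ _≤_ (sym (handshake H)) (sym ∑∑-owned) (ℕP.+-mono-≤ m≤∣∁S∣ m≤∣∁S∣))
    where
    m≤∣∁S∣ : edgeCount H ≤ ∣ ∁ S ∣
    m≤∣∁S∣ = subst (edgeCount H ≤_) (sym (∣∁p∣≡n∸∣p∣ S))
               (ℕP.m+n≤o⇒m≤o∸n (edgeCount H) (subst (_≤ n) (ℕP.+-comm ∣ S ∣ _) small))
    ∑∑-owned : ∑[ i < n ] ∑[ j < n ] (𝟙 (owns i j) + 𝟙 (owns j i)) ≡ ∣ ∁ S ∣ + ∣ ∁ S ∣
    ∑∑-owned = trans (∑∑-distrib-+ (λ i j → 𝟙 (owns i j)) (λ i j → 𝟙 (owns j i)))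
                     (cong₂ _+_ ∑∑-owns (trans (∑-comm (λ i j → 𝟙 (owns j i))) ∑∑-owns))

  edge-owned : ∀ i j → adj H i j ≡ true → owns i j ≡ true ⊎ owns j i ≡ true
  edge-owned i j ij with owns i j | owns j i | adj-≤-owns i j
  ... | true  | _     | _   = inj₁ refl
  ... | false | true  | _   = inj₂ refl
  ... | false | false | 1≤0 = ⊥-elim (ℕP.<-irrefl refl (subst (_≤ 0) (cong 𝟙 ij) 1≤0))

  owned⇒pendant : ∀ {a b} → owns a b ≡ true → Pendant H a b
  owned⇒pendant {a} {b} ab u ub with edge-owned u b ub
  ... | inj₁ ub-owned = trans (sym (proj₂ (owns⇒ ub-owned))) (proj₂ (owns⇒ ab))
  ... | inj₂ bu-owned = let u∉S , pu≡b = owns⇒ bu-owned in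
    true≢false (trans (sym (proj₁ (parent-spec u u∉S))) (trans (cong (mem S) pu≡b) (proj₁ (owns⇒ ab))))

  small-dominating-set⇒edges-essential : ∀ i j → adj H i j ≡ true → isDominating H ∁⁅ i ⸴ j ⁆ ≡ false
  small-dominating-set⇒edges-essential i j ij with edge-owned i j ij
  ... | inj₁ ij-owned = pendant-undominated H ∁⁅ i ⸴ j ⁆ (owned⇒pendant ij-owned)
                          (mem-∁⁅⸴⁆-left i j) (mem-∁⁅⸴⁆-right i j)
  ... | inj₂ ji-owned = pendant-undominated H ∁⁅ i ⸴ j ⁆ (owned⇒pendant ji-owned)
                          (mem-∁⁅⸴⁆-right i j) (mem-∁⁅⸴⁆-left i j)

-- Comparing top coefficients

RedundantEdge : ∀ {n} → Graph n → Set
RedundantEdge G = ∃₂ λ i j → i ≺ j ≡ true × adj G i j ≡ true × isDominating G ∁⁅ i ⸴ j ⁆ ≡ true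

d-∁⁅⸴⁆-< : ∀ {n} (G H : Graph (2 + n)) → edgeCount G ≡ edgeCount H → NoIsolated G → RedundantEdge G →
           (∀ i j → adj H i j ≡ true → isDominating H ∁⁅ i ⸴ j ⁆ ≡ false) → d H n < d G n
d-∁⁅⸴⁆-< {n} G H same-size no-isolated (i₀ , j₀ , i₀≺j₀ , i₀j₀ , i₀j₀-redundant) essential =
  ℕP.+-cancelʳ-< _ (d H n) (d G n) (subst₂ _<_ (∑∑-weight H (sym same-size)) (∑∑-weight G refl)
    (∑-mono-< (λ i → ∑-mono-≤ (weight-H≤weight-G i)) i₀
      (∑-mono-< (weight-H≤weight-G i₀) j₀ (ℕP.≤-<-trans (weight-H≤ i₀ j₀) <weight-G₀))))
  where
  -- A pair i ≺ j scores once if its complement dominates and once if it is an edge: at most once in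
  -- H, at least once in G (no isolated vertices), and twice for the redundant edge of G.
  weight : Graph (2 + n) → Fin (2 + n) → Fin (2 + n) → ℕ
  weight K i j = 𝟙 (i ≺ j ∧ isDominating K ∁⁅ i ⸴ j ⁆) + 𝟙 (i ≺ j ∧ adj K i j)

  ∑∑-weight : ∀ K → edgeCount K ≡ edgeCount G → ∑[ i < 2 + n ] ∑[ j < 2 + n ] weight K i j ≡ d K n + edgeCount G
  ∑∑-weight K size =
    trans (∑∑-distrib-+ (λ i j → 𝟙 (i ≺ j ∧ isDominating K ∁⁅ i ⸴ j ⁆)) (λ i j → 𝟙 (i ≺ j ∧ adj K i j)))
          (cong₂ _+_ (sym (d-∁⁅⸴⁆ K)) (trans (sym (edgeCount≡∑ K)) size))

  weight-H≤ : ∀ i j → weight H i j ≤ 𝟙 (i ≺ j)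
  weight-H≤ i j with i ≺ j
  ... | false = z≤n
  ... | true with adj H i j in ij
  ...   | true  = ℕP.≤-reflexive (cong (λ b → 𝟙 b + 1) (essential i j ij))
  ...   | false = ℕP.≤-trans (ℕP.≤-reflexive (ℕP.+-identityʳ _)) (𝟙≤1 _)

  ≤weight-G : ∀ i j → 𝟙 (i ≺ j) ≤ weight G i j
  ≤weight-G i j with i ≺ j
  ... | false = z≤n
  ... | true with adj G i j in ij
  ...   | true  = ℕP.m≤n+m 1 _
  ...   | false = ℕP.≤-reflexive (cong (λ b → 𝟙 b + 0) (sym (∁⁅⸴⁆-dominating {G = G} no-isolated ij)))

  <weight-G₀ : 𝟙 (i₀ ≺ j₀) < weight G i₀ j₀
  <weight-G₀ rewrite i₀≺j₀ | i₀j₀ | i₀j₀-redundant = ℕP.≤-refl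

  weight-H≤weight-G : ∀ i j → weight H i j ≤ weight G i j
  weight-H≤weight-G i j = ℕP.≤-trans (weight-H≤ i j) (≤weight-G i j)

d-full-≤ : ∀ {n} (G H : Graph n) → d H n ≤ d G n
d-full-≤ G H = ℕP.≤-reflexive (trans (d-full H) (sym (d-full G)))

d-∁⁅⁆-≤ : ∀ {n} (G H : Graph (suc n)) → NoIsolated G → d H n ≤ d G n
d-∁⁅⁆-≤ G H no-isolated = subst₂ _≤_ (sym (d-∁⁅⁆ H)) (sym (d-∁⁅⁆ G)) (∑-mono-≤ λ i →
  subst (𝟙 (isDominating H ∁⁅ i ⁆) ≤_) (cong 𝟙 (sym (∁⁅⁆-dominating {G = G} no-isolated i))) (𝟙≤1 _))

-- Evaluating D at N and at 1/N

poly : (ℕ → ℕ) → ℕ → ℕ → ℕ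
poly a N zero    = 0
poly a N (suc k) = poly a N k + a (suc k) * N ^ suc k

revPoly : (ℕ → ℕ) → ℕ → ℕ → ℕ
revPoly a N zero    = 0
revPoly a N (suc k) = revPoly a N k * N + a (suc k)

poly-<-step : ∀ {a b} N k → poly a N k < poly b N k → a (suc k) ≤ b (suc k) →
              poly a N (suc k) < poly b N (suc k)
poly-<-step N k p<q a≤b = ℕP.+-mono-<-≤ p<q (ℕP.*-monoˡ-≤ (N ^ suc k) a≤b)

revPoly-vanishing : ∀ {a} N k → (∀ i → i < k → a (suc i) ≡ 0) → revPoly a N k ≡ 0
revPoly-vanishing     N zero    _      = refl
revPoly-vanishing {a} N (suc k) vanish
  rewrite revPoly-vanishing {a} N k (λ i i<k → vanish i (ℕP.m<n⇒m<1+n i<k)) = vanish k ℕP.≤-refl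

pow≤revPoly : ∀ {b} N j → 0 < b (suc j) → ∀ t → N ^ t ≤ revPoly b N (suc j + t)
pow≤revPoly N j 0<b zero    rewrite ℕP.+-identityʳ j = ℕP.≤-trans 0<b (ℕP.m≤n+m _ _)
pow≤revPoly {b} N j 0<b (suc t) rewrite ℕP.+-suc j t = begin
  N * N ^ t                        ≡⟨ ℕP.*-comm N (N ^ t) ⟩
  N ^ t * N                        ≤⟨ ℕP.*-monoˡ-≤ N (pow≤revPoly N j 0<b t) ⟩
  revPoly b N (suc j + t) * N      ≤⟨ ℕP.m≤m+n _ _ ⟩
  revPoly b N (suc j + t) * N + b (suc (suc j + t)) ∎
  where open ℕP.≤-Reasoning

module _ {a : ℕ → ℕ} {B N : ℕ} (a≤B : ∀ i → a i ≤ B) (B<N : B < N) where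

  poly<pow : ∀ k → poly a N k < N ^ suc k
  poly<pow zero    = subst (0 <_) (sym (ℕP.*-identityʳ N)) (ℕP.≤-<-trans z≤n B<N)
  poly<pow (suc k) = begin
    suc (poly a N k) + a (suc k) * N ^ suc k
      ≤⟨ ℕP.+-mono-≤ (poly<pow k) (ℕP.*-monoˡ-≤ (N ^ suc k) (a≤B (suc k))) ⟩
    N ^ suc k + B * N ^ suc k                ≡⟨⟩
    suc B * N ^ suc k                        ≤⟨ ℕP.*-monoˡ-≤ (N ^ suc k) B<N ⟩
    N * N ^ suc k                            ∎
    where open ℕP.≤-Reasoning

  poly-<-top : ∀ {b} k → a (suc k) < b (suc k) → poly a N (suc k) < poly b N (suc k)
  poly-<-top {b} k a<b = begin-strict
    poly a N k + a (suc k) * N ^ suc k <⟨ ℕP.+-monoˡ-< (a (suc k) * N ^ suc k) (poly<pow k) ⟩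
    suc (a (suc k)) * N ^ suc k        ≤⟨ ℕP.*-monoˡ-≤ (N ^ suc k) a<b ⟩
    b (suc k) * N ^ suc k              ≤⟨ ℕP.m≤n+m _ (poly b N k) ⟩
    poly b N k + b (suc k) * N ^ suc k ∎
    where open ℕP.≤-Reasoning

  revPoly<pow : ∀ k → revPoly a N k ≡ 0 → ∀ t → revPoly a N (k + t) < N ^ t
  revPoly<pow k vanish zero rewrite ℕP.+-identityʳ k | vanish = ℕP.0<1+n
  revPoly<pow k vanish (suc t) rewrite ℕP.+-suc k t = begin-strict
    revPoly a N (k + t) * N + a (suc (k + t))
      <⟨ ℕP.+-monoʳ-< (revPoly a N (k + t) * N) (ℕP.≤-<-trans (a≤B _) B<N) ⟩
    revPoly a N (k + t) * N + N               ≡⟨ ℕP.+-comm _ N ⟩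
    suc (revPoly a N (k + t)) * N             ≤⟨ ℕP.*-monoˡ-≤ N (revPoly<pow k vanish t) ⟩
    N ^ t * N                                 ≡⟨ ℕP.*-comm (N ^ t) N ⟩
    N ^ suc t                                 ∎
    where open ℕP.≤-Reasoning

  revPoly-< : ∀ {b} n k j → (∀ i → i < k → a (suc i) ≡ 0) → 0 < b (suc j) → j < k → k ≤ n →
              revPoly a N n < revPoly b N n
  revPoly-< {b} n k j vanish 0<b j<k k≤n = begin-strict
    revPoly a N n                     ≡⟨ cong (revPoly a N) (sym (ℕP.m+[n∸m]≡n k≤n)) ⟩
    revPoly a N (k + (n ∸ k))         <⟨ revPoly<pow k (revPoly-vanishing N k vanish) (n ∸ k) ⟩
    N ^ (n ∸ k)
      ≤⟨ ℕP.^-monoʳ-≤ N {{ℕ.>-nonZero (ℕP.≤-<-trans z≤n B<N)}} (ℕP.∸-monoʳ-≤ n j<k) ⟩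
    N ^ (n ∸ suc j)                   ≤⟨ pow≤revPoly N j 0<b (n ∸ suc j) ⟩
    revPoly b N (suc j + (n ∸ suc j)) ≡⟨ cong (revPoly b N) (ℕP.m+[n∸m]≡n (ℕP.≤-trans j<k k≤n)) ⟩
    revPoly b N n                     ∎
    where open ℕP.≤-Reasoning

coprime-1 : ∀ a → Coprime a 1
coprime-1 a (_ , c∣1) = ∣1⇒≡1 c∣1

ℕ→ℚ≡mkℚ : ∀ a → ℕ→ℚ a ≡ mkℚ (ℤ.+ a) 0 (coprime-1 a)
ℕ→ℚ≡mkℚ a = ℚP.normalize-coprime (coprime-1 a)

ℕ→ℚ-nonNeg : ∀ a → ℚ.NonNegative (ℕ→ℚ a)
ℕ→ℚ-nonNeg a rewrite ℕ→ℚ≡mkℚ a = _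

ℕ→ℚ-mono-< : ∀ {a b} → a < b → ℕ→ℚ a ℚ.< ℕ→ℚ b
ℕ→ℚ-mono-< {a} {b} a<b rewrite ℕ→ℚ≡mkℚ a | ℕ→ℚ≡mkℚ b =
  ℚ.*<* (subst₂ ℤ._<_ (sym (ℤP.*-identityʳ (ℤ.+ a))) (sym (ℤP.*-identityʳ (ℤ.+ b))) (ℤ.+<+ a<b))

ℕ→ℚ-+ : ∀ a b → ℕ→ℚ (a + b) ≡ ℕ→ℚ a ℚ.+ ℕ→ℚ b
ℕ→ℚ-+ a b = ℚP.toℚᵘ-injective (ℚᵘP.≃-trans homo (ℚᵘP.≃-sym (ℚP.toℚᵘ-homo-+ (ℕ→ℚ a) (ℕ→ℚ b))))
  where
  homo : ℚ.toℚᵘ (ℕ→ℚ (a + b)) ℚᵘ.≃ ℚ.toℚᵘ (ℕ→ℚ a) ℚᵘ.+ ℚ.toℚᵘ (ℕ→ℚ b)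
  homo rewrite ℕ→ℚ≡mkℚ (a + b) | ℕ→ℚ≡mkℚ a | ℕ→ℚ≡mkℚ b = ℚᵘ.*≡* (cong (ℤ._* ℤ.+ 1)
    (trans (ℤP.pos-+ a b) (sym (cong₂ ℤ._+_ (ℤP.*-identityʳ (ℤ.+ a)) (ℤP.*-identityʳ (ℤ.+ b))))))

ℕ→ℚ-* : ∀ a b → ℕ→ℚ (a * b) ≡ ℕ→ℚ a ℚ.* ℕ→ℚ b
ℕ→ℚ-* a b = ℚP.toℚᵘ-injective (ℚᵘP.≃-trans homo (ℚᵘP.≃-sym (ℚP.toℚᵘ-homo-* (ℕ→ℚ a) (ℕ→ℚ b))))
  where
  homo : ℚ.toℚᵘ (ℕ→ℚ (a * b)) ℚᵘ.≃ ℚ.toℚᵘ (ℕ→ℚ a) ℚᵘ.* ℚ.toℚᵘ (ℕ→ℚ b)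
  homo rewrite ℕ→ℚ≡mkℚ (a * b) | ℕ→ℚ≡mkℚ a | ℕ→ℚ≡mkℚ b = ℚᵘ.*≡* (cong (ℤ._* ℤ.+ 1) (ℤP.pos-* a b))

pow-ℕ→ℚ : ∀ N k → pow (ℕ→ℚ N) k ≡ ℕ→ℚ (N ^ k)
pow-ℕ→ℚ N zero    = refl
pow-ℕ→ℚ N (suc k) = trans (cong (ℕ→ℚ N ℚ.*_) (pow-ℕ→ℚ N k)) (sym (ℕ→ℚ-* N (N ^ k)))

1/suc : ℕ → ℚ
1/suc N = ℤ.+ 1 / suc N

1/suc-nonNeg : ∀ N → 0ℚ ℚ.≤ 1/suc N
1/suc-nonNeg N = ℚP.nonNegative⁻¹ (1/suc N) {{ℚP.normalize-nonNeg 1 (suc N)}}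

1/suc-inverse : ∀ N → 1/suc N ℚ.* ℕ→ℚ (suc N) ≡ 1ℚ
1/suc-inverse N = ℚP.toℚᵘ-injective (ℚᵘP.≃-trans (ℚP.toℚᵘ-homo-* (1/suc N) (ℕ→ℚ (suc N)))
  (ℚᵘP.≃-trans (ℚᵘP.*-cong (ℚP.toℚᵘ-fromℚᵘ (mkℚᵘ (ℤ.+ 1) N)) suc-N) product))
  where
  suc-N : ℚ.toℚᵘ (ℕ→ℚ (suc N)) ℚᵘ.≃ mkℚᵘ (ℤ.+ suc N) 0
  suc-N rewrite ℕ→ℚ≡mkℚ (suc N) = ℚᵘP.≃-refl
  product : mkℚᵘ (ℤ.+ 1) N ℚᵘ.* mkℚᵘ (ℤ.+ suc N) 0 ℚᵘ.≃ ℚ.toℚᵘ 1ℚ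
  product = ℚᵘ.*≡* (cong (λ k → ℤ.+ suc k)
    (trans (ℕP.*-identityʳ (N + 0)) (cong (_+ 0) (sym (ℕP.*-identityʳ N)))))

pow-1/suc : ∀ N k → pow (1/suc N) k ℚ.* ℕ→ℚ (suc N ^ k) ≡ 1ℚ
pow-1/suc N zero    = ℚP.*-identityˡ 1ℚ
pow-1/suc N (suc k) = begin
  (1/suc N ℚ.* pow (1/suc N) k) ℚ.* ℕ→ℚ (suc N * suc N ^ k)
    ≡⟨ cong ((1/suc N ℚ.* pow (1/suc N) k) ℚ.*_) (ℕ→ℚ-* (suc N) (suc N ^ k)) ⟩
  (1/suc N ℚ.* pow (1/suc N) k) ℚ.* (ℕ→ℚ (suc N) ℚ.* ℕ→ℚ (suc N ^ k))
    ≡⟨ interchange (1/suc N) (pow (1/suc N) k) (ℕ→ℚ (suc N)) (ℕ→ℚ (suc N ^ k)) ⟩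
  (1/suc N ℚ.* ℕ→ℚ (suc N)) ℚ.* (pow (1/suc N) k ℚ.* ℕ→ℚ (suc N ^ k))
    ≡⟨ cong₂ ℚ._*_ (1/suc-inverse N) (pow-1/suc N k) ⟩
  1ℚ ℚ.* 1ℚ
    ≡⟨ ℚP.*-identityˡ 1ℚ ⟩
  1ℚ ∎
  where open ≡-Reasoning

Dsum-at-ℕ : ∀ {n} (G : Graph n) N k → Dsum G (ℕ→ℚ N) k ≡ ℕ→ℚ (poly (d G) N k)
Dsum-at-ℕ G N zero    = refl
Dsum-at-ℕ G N (suc k) = begin
  Dsum G (ℕ→ℚ N) k ℚ.+ ℕ→ℚ (d G (suc k)) ℚ.* pow (ℕ→ℚ N) (suc k)
    ≡⟨ cong₂ ℚ._+_ (Dsum-at-ℕ G N k) (cong (ℕ→ℚ (d G (suc k)) ℚ.*_) (pow-ℕ→ℚ N (suc k))) ⟩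
  ℕ→ℚ (poly (d G) N k) ℚ.+ ℕ→ℚ (d G (suc k)) ℚ.* ℕ→ℚ (N ^ suc k)
    ≡⟨ cong (ℕ→ℚ (poly (d G) N k) ℚ.+_) (sym (ℕ→ℚ-* (d G (suc k)) (N ^ suc k))) ⟩
  ℕ→ℚ (poly (d G) N k) ℚ.+ ℕ→ℚ (d G (suc k) * N ^ suc k)
    ≡⟨ sym (ℕ→ℚ-+ (poly (d G) N k) _) ⟩
  ℕ→ℚ (poly (d G) N (suc k)) ∎
  where open ≡-Reasoning

Dsum-at-1/suc : ∀ {n} (G : Graph n) N k →
                Dsum G (1/suc N) k ℚ.* ℕ→ℚ (suc N ^ k) ≡ ℕ→ℚ (revPoly (d G) (suc N) k)
Dsum-at-1/suc G N zero    = ℚP.*-zeroˡ (ℕ→ℚ 1)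
Dsum-at-1/suc G N (suc k) = begin
  (Dsum G x k ℚ.+ ℕ→ℚ dₖ ℚ.* pow x (suc k)) ℚ.* ℕ→ℚ (N′ ^ suc k)
    ≡⟨ ℚP.*-distribʳ-+ (ℕ→ℚ (N′ ^ suc k)) (Dsum G x k) _ ⟩
  Dsum G x k ℚ.* ℕ→ℚ (N′ ^ suc k) ℚ.+ (ℕ→ℚ dₖ ℚ.* pow x (suc k)) ℚ.* ℕ→ℚ (N′ ^ suc k)
    ≡⟨ cong₂ ℚ._+_ lower-terms top-term ⟩
  ℕ→ℚ (revPoly (d G) N′ k) ℚ.* ℕ→ℚ N′ ℚ.+ ℕ→ℚ dₖ
    ≡⟨ cong (ℚ._+ ℕ→ℚ dₖ) (sym (ℕ→ℚ-* (revPoly (d G) N′ k) N′)) ⟩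
  ℕ→ℚ (revPoly (d G) N′ k * N′) ℚ.+ ℕ→ℚ dₖ
    ≡⟨ sym (ℕ→ℚ-+ (revPoly (d G) N′ k * N′) dₖ) ⟩
  ℕ→ℚ (revPoly (d G) N′ (suc k)) ∎
  where
  open ≡-Reasoning
  x  = 1/suc N
  N′ = suc N
  dₖ = d G (suc k)
  lower-terms : Dsum G x k ℚ.* ℕ→ℚ (N′ ^ suc k) ≡ ℕ→ℚ (revPoly (d G) N′ k) ℚ.* ℕ→ℚ N′
  lower-terms = begin
    Dsum G x k ℚ.* ℕ→ℚ (N′ * N′ ^ k)
      ≡⟨ cong (Dsum G x k ℚ.*_) (trans (cong ℕ→ℚ (ℕP.*-comm N′ (N′ ^ k))) (ℕ→ℚ-* (N′ ^ k) N′)) ⟩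
    Dsum G x k ℚ.* (ℕ→ℚ (N′ ^ k) ℚ.* ℕ→ℚ N′)
      ≡⟨ sym (ℚP.*-assoc (Dsum G x k) (ℕ→ℚ (N′ ^ k)) (ℕ→ℚ N′)) ⟩
    (Dsum G x k ℚ.* ℕ→ℚ (N′ ^ k)) ℚ.* ℕ→ℚ N′
      ≡⟨ cong (ℚ._* ℕ→ℚ N′) (Dsum-at-1/suc G N k) ⟩
    ℕ→ℚ (revPoly (d G) N′ k) ℚ.* ℕ→ℚ N′ ∎
  top-term : (ℕ→ℚ dₖ ℚ.* pow x (suc k)) ℚ.* ℕ→ℚ (N′ ^ suc k) ≡ ℕ→ℚ dₖ
  top-term = trans (ℚP.*-assoc (ℕ→ℚ dₖ) (pow x (suc k)) (ℕ→ℚ (N′ ^ suc k)))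
                   (trans (cong (ℕ→ℚ dₖ ℚ.*_) (pow-1/suc N (suc k))) (ℚP.*-identityʳ (ℕ→ℚ dₖ)))

Beats : ∀ {n} → Graph n → Graph n → Set
Beats G H = ∃[ x ] 0ℚ ℚ.≤ x × D H x ℚ.< D G x

beats-at-ℕ : ∀ {n} (G H : Graph n) N → poly (d H) N n < poly (d G) N n → Beats G H
beats-at-ℕ {n} G H N H<G = ℕ→ℚ N , ℚP.nonNegative⁻¹ (ℕ→ℚ N) {{ℕ→ℚ-nonNeg N}} ,
  subst₂ ℚ._<_ (sym (Dsum-at-ℕ H N n)) (sym (Dsum-at-ℕ G N n)) (ℕ→ℚ-mono-< H<G)

beats-at-1/suc : ∀ {n} (G H : Graph n) N → revPoly (d H) (suc N) n < revPoly (d G) (suc N) n → Beats G H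
beats-at-1/suc {n} G H N H<G = 1/suc N , 1/suc-nonNeg N ,
  ℚP.*-cancelʳ-<-nonNeg (ℕ→ℚ (suc N ^ n)) {{ℕ→ℚ-nonNeg (suc N ^ n)}}
    (subst₂ ℚ._<_ (sym (Dsum-at-1/suc H N n)) (sym (Dsum-at-1/suc G N n)) (ℕ→ℚ-mono-< H<G))

top-coefficients⇒beats : ∀ {r} (G H : Graph (suc (suc (suc r)))) → d H (suc r) < d G (suc r) →
  d H (suc (suc r)) ≤ d G (suc (suc r)) → d H (suc (suc (suc r))) ≤ d G (suc (suc (suc r))) → Beats G H
top-coefficients⇒beats {r} G H <₁ ≤₂ ≤₃ = beats-at-ℕ G H N
  (poly-<-step N (suc (suc r)) (poly-<-step N (suc r) (poly-<-top (d≤2^n H) ℕP.≤-refl r <₁) ≤₂) ≤₃)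
  where N = suc (2 ^ suc (suc (suc r)))

smaller-dominating-set⇒beats : ∀ {n} (G H : Graph n) T → isDominating G T ≡ true → 0 < ∣ T ∣ →
  (∀ S → isDominating H S ≡ true → ∣ T ∣ < ∣ S ∣) → Beats G H
smaller-dominating-set⇒beats {n} G H T T-dominating 0<∣T∣ smaller
  with ∣ T ∣ | d-pos G T T-dominating | ∣p∣≤n T
... | suc j | 0<d | k≤n = beats-at-1/suc G H (2 ^ n)
  (revPoly-< (d≤2^n H) ℕP.≤-refl n (suc j) j vanish 0<d ℕP.≤-refl k≤n)
  where
  vanish : ∀ i → i < suc j → d H (suc i) ≡ 0
  vanish i i<k = d-vanishes H (suc i) λ S S-dominating ∣S∣≡ →
    ℕP.<⇒≱ (smaller S S-dominating) (subst (_≤ suc j) (sym ∣S∣≡) i<k)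

-- The competitors

∣++∣ : ∀ {a b} (p : Subset a) (q : Subset b) → ∣ p ++ q ∣ ≡ ∣ p ∣ + ∣ q ∣
∣++∣ []          q = refl
∣++∣ (true  ∷ p) q = cong suc (∣++∣ p q)
∣++∣ (false ∷ p) q = ∣++∣ p q

edgeless : ∀ n → Graph n
edgeless zero    = record { adj = λ () ; sym = λ () ; irrefl = λ () }
edgeless (suc n) = cons ⊥ (edgeless n)

edgeCount-edgeless : ∀ n → edgeCount (edgeless n) ≡ 0
edgeCount-edgeless zero    = refl
edgeCount-edgeless (suc n) = trans (edgeCount-cons-⊥ (edgeless n)) (edgeCount-edgeless n)

cons-∁-dominating : ∀ {n} (N : Subset n) (G : Graph n) → isDominating (cons N G) (true ∷ ∁ N) ≡ true
cons-∁-dominating N G = dominating⁺ (cons N G) (true ∷ ∁ N) dominated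
  where
  dominated : ∀ v → mem (true ∷ ∁ N) v ≡ false → ∃[ u ] mem (true ∷ ∁ N) u ≡ true × adj (cons N G) u v ≡ true
  dominated (suc w) w∉∁N = zero , refl , not-injective (trans (sym (lookup-map w not N)) w∉∁N)

star-competitor : ∀ {n m} → m < n →
  Σ (Graph n) λ G → edgeCount G ≡ m × ∃[ T ] isDominating G T ≡ true × 0 < ∣ T ∣ × ∣ T ∣ + m ≡ n
star-competitor {m = m} m<n with ℕP.m≤n⇒∃[o]m+o≡n m<n
... | q , refl =
  cons N (edgeless (m + q)) , edges , true ∷ ∁ N , cons-∁-dominating N (edgeless (m + q)) , ℕP.0<1+n , size
  where
  N : Subset (m + q)
  N = ⊤ {n = m} ++ ⊥ {n = q}
  ∣N∣ : ∣ N ∣ ≡ m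
  ∣N∣ = trans (∣++∣ (⊤ {n = m}) ⊥) (trans (cong₂ _+_ (∣⊤∣≡n m) (∣⊥∣≡0 q)) (ℕP.+-identityʳ m))
  edges : edgeCount (cons N (edgeless (m + q))) ≡ m
  edges = trans (edgeCount-cons N _) (trans (cong₂ _+_ ∣N∣ (edgeCount-edgeless (m + q))) (ℕP.+-identityʳ m))
  size : ∣ true ∷ ∁ N ∣ + m ≡ suc (m + q)
  size = cong suc (trans (cong (_+ m) (trans (∣∁p∣≡n∸∣p∣ N) (trans (cong (m + q ∸_) ∣N∣) (ℕP.m+n∸m≡n m q))))
                         (ℕP.+-comm q m))

withMatching : ∀ p {n} → Graph n → Graph (p * 2 + n)
withMatching zero    G = G
withMatching (suc p) G = cons (true ∷ ⊥) (cons ⊥ (withMatching p G))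

edgeCount-withMatching : ∀ p {n} (G : Graph n) → edgeCount (withMatching p G) ≡ p + edgeCount G
edgeCount-withMatching zero    G = refl
edgeCount-withMatching (suc p) {n} G =
  trans (edgeCount-cons (true ∷ ⊥) (cons ⊥ (withMatching p G)))
        (cong₂ (λ a b → suc (a + b)) (∣⊥∣≡0 (p * 2 + n))
               (trans (edgeCount-cons-⊥ (withMatching p G)) (edgeCount-withMatching p G)))

matched-or-in-tail : ∀ p {n} {G : Graph n} (v : Fin (p * 2 + n)) →
  lookup (⊥ {n = p * 2} ++ ⊤ {n = n}) v ≡ true ⊎ ∃[ u ] adj (withMatching p G) u v ≡ true
matched-or-in-tail zero    v             = inj₁ (mem-⊤ v)
matched-or-in-tail (suc p) zero          = inj₂ (suc zero , refl)
matched-or-in-tail (suc p) (suc zero)    = inj₂ (zero , refl)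
matched-or-in-tail (suc p) (suc (suc w)) with matched-or-in-tail p w
... | inj₁ in-tail  = inj₁ in-tail
... | inj₂ (u , uw) = inj₂ (suc (suc u) , uw)

-- Vertex 0 is adjacent to 1 and 2, vertex 2 to the last t + 1 vertices, and the p * 2 vertices in
-- between are matched in pairs.
doubleStar : ∀ t p → Graph (3 + (p * 2 + suc t))
doubleStar t p = cons (true ∷ true ∷ ⊥) (cons ⊥ (cons (⊥ {n = p * 2} ++ ⊤) (withMatching p (edgeless (suc t)))))

edgeCount-doubleStar : ∀ t p → edgeCount (doubleStar t p) ≡ 3 + t + p
edgeCount-doubleStar t p = begin
  edgeCount (doubleStar t p)
    ≡⟨ edgeCount-cons (true ∷ true ∷ ⊥) (cons ⊥ (cons N M)) ⟩
  2 + ∣ ⊥ {n = p * 2 + suc t} ∣ + edgeCount (cons ⊥ (cons N M))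
    ≡⟨ cong₂ _+_ (cong (2 +_) (∣⊥∣≡0 (p * 2 + suc t))) (edgeCount-cons-⊥ (cons N M)) ⟩
  2 + edgeCount (cons N M)
    ≡⟨ cong (2 +_) (edgeCount-cons N M) ⟩
  2 + (∣ N ∣ + edgeCount M)
    ≡⟨ cong₂ (λ a b → 2 + (a + b)) ∣N∣ edges-M ⟩
  3 + t + p ∎
  where
  open ≡-Reasoning
  N : Subset (p * 2 + suc t)
  N = ⊥ {n = p * 2} ++ ⊤ {n = suc t}
  M : Graph (p * 2 + suc t)
  M = withMatching p (edgeless (suc t))
  ∣N∣ : ∣ N ∣ ≡ suc t
  ∣N∣ = trans (∣++∣ (⊥ {n = p * 2}) ⊤) (cong₂ _+_ (∣⊥∣≡0 (p * 2)) (∣⊤∣≡n (suc t)))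
  edges-M : edgeCount M ≡ p
  edges-M = trans (edgeCount-withMatching p (edgeless (suc t)))
                  (trans (cong (p +_) (edgeCount-edgeless (suc t))) (ℕP.+-identityʳ p))

doubleStar-noIsolated : ∀ t p → NoIsolated (doubleStar t p)
doubleStar-noIsolated t p zero                = suc zero , refl
doubleStar-noIsolated t p (suc zero)          = zero , refl
doubleStar-noIsolated t p (suc (suc zero))    = zero , refl
doubleStar-noIsolated t p (suc (suc (suc w))) with matched-or-in-tail p {G = edgeless (suc t)} w
... | inj₁ leaf     = suc (suc zero) , leaf
... | inj₂ (u , uw) = suc (suc (suc u)) , uw

doubleStar-redundantEdge : ∀ t p → RedundantEdge (doubleStar t p)
doubleStar-redundantEdge t p =
  zero , suc (suc zero) , refl , refl , dominating⁺ (doubleStar t p) ∁⁅ zero ⸴ suc (suc zero) ⁆ dominated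
  where
  dominated : ∀ v → mem ∁⁅ zero ⸴ suc (suc zero) ⁆ v ≡ false →
              ∃[ u ] mem ∁⁅ zero ⸴ suc (suc zero) ⁆ u ≡ true × adj (doubleStar t p) u v ≡ true
  dominated zero                _  = suc zero , refl , refl
  dominated (suc (suc zero))    _  =
    suc (suc (suc (p * 2 ↑ʳ zero))) , mem-⊤ (p * 2 ↑ʳ zero) , lookup-++ʳ (⊥ {n = p * 2}) ⊤ zero
  dominated (suc (suc (suc w))) w∉ = true≢false (trans (sym (mem-⊤ w)) w∉)

n≤⌈n/2⌉+⌈n/2⌉ : ∀ n → n ≤ ⌈ n /2⌉ + ⌈ n /2⌉
n≤⌈n/2⌉+⌈n/2⌉ n =
  subst (_≤ ⌈ n /2⌉ + ⌈ n /2⌉) (ℕP.⌊n/2⌋+⌈n/2⌉≡n n) (ℕP.+-monoˡ-≤ ⌈ n /2⌉ (ℕP.⌊n/2⌋≤⌈n/2⌉ n))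

doubleStar-size : ∀ {n m} → ⌈ n /2⌉ < m → m < n → ∃₂ λ t p → n ≡ 3 + (p * 2 + suc t) × m ≡ 3 + t + p
doubleStar-size {m = m} ⌈n/2⌉<m m<n with ℕP.m≤n⇒∃[o]m+o≡n m<n
... | p , refl with ℕP.m≤n⇒∃[o]m+o≡n 3+p≤m
  where
  3+p≤m : 3 + p ≤ m
  3+p≤m = ℕP.+-cancelˡ-≤ m (3 + p) m (begin
    m + (3 + p)                           ≡⟨ shift m p ⟩
    suc m + p + 2                         ≤⟨ ℕP.+-monoˡ-≤ 2 (n≤⌈n/2⌉+⌈n/2⌉ (suc m + p)) ⟩
    ⌈ suc m + p /2⌉ + ⌈ suc m + p /2⌉ + 2 ≡⟨ double-suc ⌈ suc m + p /2⌉ ⟩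
    suc ⌈ suc m + p /2⌉ + suc ⌈ suc m + p /2⌉ ≤⟨ ℕP.+-mono-≤ ⌈n/2⌉<m ⌈n/2⌉<m ⟩
    m + m                                 ∎)
    where
    open ℕP.≤-Reasoning
    shift : ∀ m p → m + (3 + p) ≡ suc m + p + 2
    shift = solve-∀
    double-suc : ∀ c → c + c + 2 ≡ suc c + suc c
    double-suc = solve-∀
... | t , refl = t , p , total t p , edges t p
  where
  total : ∀ t p → suc (3 + p + t + p) ≡ 3 + (p * 2 + suc t)
  total = solve-∀
  edges : ∀ t p → 3 + p + t ≡ 3 + t + p
  edges = solve-∀

doubleStar-competitor : ∀ {n m} → ⌈ n /2⌉ < m → m < n →
  Σ (Graph n) λ G → edgeCount G ≡ m × NoIsolated G × RedundantEdge G
doubleStar-competitor ⌈n/2⌉<m m<n with doubleStar-size ⌈n/2⌉<m m<n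
... | t , p , refl , refl = doubleStar t p , edgeCount-doubleStar t p , doubleStar-noIsolated t p ,
                            doubleStar-redundantEdge t p

beaten-by-doubleStar : ∀ {r m} (H : Graph (suc (suc (suc r)))) →
  ⌈ suc (suc (suc r)) /2⌉ < m → m < suc (suc (suc r)) → edgeCount H ≡ m →
  ∀ S → isDominating H S ≡ true → ∣ S ∣ + m ≤ suc (suc (suc r)) →
  Σ (Graph (suc (suc (suc r)))) λ G → edgeCount G ≡ m × Beats G H
beaten-by-doubleStar H ⌈n/2⌉<m m<n refl S S-dominating ∣S∣+m≤n =
  let G , G-size , G-noIsolated , G-redundant = doubleStar-competitor ⌈n/2⌉<m m<n
  in G , G-size , top-coefficients⇒beats G H
       (d-∁⁅⸴⁆-< G H G-size G-noIsolated G-redundant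
          (small-dominating-set⇒edges-essential H S S-dominating ∣S∣+m≤n))
       (d-∁⁅⁆-≤ G H G-noIsolated)
       (d-full-≤ G H)

beaten-by-star : ∀ {n m} (H : Graph n) → m < n → (∀ S → isDominating H S ≡ true → ¬ ∣ S ∣ + m ≤ n) →
  Σ (Graph n) λ G → edgeCount G ≡ m × Beats G H
beaten-by-star {m = m} H m<n no-small-set =
  let G , G-size , T , T-dominating , 0<∣T∣ , ∣T∣+m≡n = star-competitor m<n
  in G , G-size , smaller-dominating-set⇒beats G H T T-dominating 0<∣T∣ λ S S-dominating →
       ℕP.≰⇒> λ ∣S∣≤∣T∣ →
         no-small-set S S-dominating (subst (∣ S ∣ + m ≤_) ∣T∣+m≡n (ℕP.+-monoˡ-≤ m ∣S∣≤∣T∣))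

optimal-unbeaten : ∀ {n m} {H G : Graph n} → Optimal n m H → edgeCount G ≡ m → ¬ Beats G H
optimal-unbeaten (_ , H-optimal) G-size (x , 0≤x , H<G) =
  ℚP.<-irrefl refl (ℚP.<-≤-trans H<G (H-optimal _ G-size x 0≤x))

theorem2p8 : (n m : ℕ) → 4 ≤ n → ⌈ n /2⌉ < m → m ≤ n ∸ 1 →
    (H : Graph n) → ¬ Optimal n m H
theorem2p8 n@(suc (suc (suc (suc _)))) m (s≤s (s≤s (s≤s (s≤s z≤n)))) ⌈n/2⌉<m m≤n∸1 H
           H-optimal@(H-size , _) =
  refute (anySubset? λ S → (isDominating H S ≟ᵇ true) ×-dec (∣ S ∣ + m ℕP.≤? n))
  where
  -- A `with` on the decision would make Agda normalise Optimal n m H, and with it D H, which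
  -- enumerates all 2ⁿ subsets.
  refute : Dec (∃ λ S → isDominating H S ≡ true × ∣ S ∣ + m ≤ n) → Empty.⊥
  refute (yes (S , S-dominating , small)) =
    let G , G-size , G-beats-H = beaten-by-doubleStar H ⌈n/2⌉<m (s≤s m≤n∸1) H-size S S-dominating small
    in optimal-unbeaten H-optimal G-size G-beats-H
  refute (no ∄S) =
    let G , G-size , G-beats-H =
          beaten-by-star H (s≤s m≤n∸1) λ S S-dominating small → ∄S (S , S-dominating , small)
    in optimal-unbeaten H-optimal G-size G-beats-H
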